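{- Let $G$ be a graph of order $n$ with minimum degree $\delta(G)=1$ and with no full vertex. Then $\mathcal{C}(G)=n$ if and only if $G\in\mathcal{F}_1$.
   Context: All graphs are finite and simple. For a graph $G$ with vertex set $V$, a set $S\subseteq V$ is a dominating set if every vertex of $V\setminus S$ is adjacent to a vertex of $S$. Two disjoint sets $V_1,V_2\subseteq V$ form a coalition in $G$ if neither is a dominating set of $G$ but $V_1\cup V_2$ is. A coalition partition of $G$ is a partition $\Psi=\{V_1,\ldots,V_k\}$ of $V$ such that every $V_i\in\Psi$ is either a dominating set of $G$ with $|V_i|=1$, or is not a dominating set and forms a coalition with some $V_j\in\Psi$. The coalition number $\mathcal{C}(G)$ is the maximum cardinality of a coalition partition of $G$. The order is $n=|V|$; a full vertex is a vertex of degree $n-1$. The family $\mathcal{F}_1$ consists of all isolate-free graphs $G$ constructed as follows. The vertex set is $V(G)=\{x,y,w\}\cup P\cup Q$, where $\{x,y,w\}$, $P$, $Q$ are pairwise disjoint, $|P\cup Q|\ge 1$, and if $Q\neq\emptyset$ then $|Q|\ge 2$. The edges are: $N_G(x)=\{y\}$ and $N_G(w)=P\cup Q$; each vertex $p\in P$ is joined to every vertex of $(P\cup Q)\setminus\{p\}$; if $Q\neq\emptyset$, then $y$ is joined to every vertex of $Q$, and some edges (possibly none) are added among vertices of $Q$ in such a way that $G[Q]$ has no full vertex (i.e., every $q\in Q$ is nonadjacent to at least one vertex of $Q\setminus\{q\}$); finally, any number of edges (possibly none) are added between $y$ and vertices of $P$. No other edges are present. -}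

module Defs where

open import Data.Nat using (ℕ; _≤_; _∸_)
open import Data.Bool using (Bool; true; false; if_then_else_)
open import Data.Fin using (Fin)
open import Data.List using (List; map; allFin)
open import Data.Nat.ListAction using (sum)
open import Data.Product using (Σ; ∃; ∃-syntax; _×_; _,_)
open import Data.Sum using (_⊎_)
open import Data.Empty using (⊥)
open import Relation.Nullary using (¬_)
open import Relation.Binary.PropositionalEquality using (_≡_; _≢_)

record Graph (n : ℕ) : Set where
  field
    adj    : Fin n → Fin n → Bool
    sym    : ∀ u v → adj u v ≡ adj v u
    irrefl : ∀ v → adj v v ≡ false
open Graph public

module _ {n : ℕ} (G : Graph n) where

  Adj : Fin n → Fin n → Set
  Adj u v = adj G u v ≡ true

  degree : Fin n → ℕ
  degree v = sum (map (λ u → if adj G v u then 1 else 0) (allFin n))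

  MinDegree : ℕ → Set
  MinDegree d = (∀ v → d ≤ degree v) × (∃[ v ] degree v ≡ d)

  FullVertex : Fin n → Set
  FullVertex v = degree v ≡ n ∸ 1

  HasFullVertex : Set
  HasFullVertex = ∃[ v ] FullVertex v

  VSet : Set₁
  VSet = Fin n → Set

  Dominating : VSet → Set
  Dominating S = ∀ v → S v ⊎ (∃[ u ] (S u × Adj u v))

  _∪_ : VSet → VSet → VSet
  (S ∪ T) v = S v ⊎ T v

  Disjoint : VSet → VSet → Set
  Disjoint S T = ∀ v → S v → T v → ⊥

  Coalition : VSet → VSet → Set
  Coalition S T = Disjoint S T × ¬ Dominating S × ¬ Dominating T × Dominating (S ∪ T)

  Singleton : VSet → Set
  Singleton S = ∃[ v ] (S v × (∀ u → S u → u ≡ v))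

  record CoalitionPartition (k : ℕ) : Set where
    field
      part     : Fin n → Fin k
      nonempty : ∀ (i : Fin k) → ∃[ v ] part v ≡ i
    Block : Fin k → VSet
    Block i v = part v ≡ i
    field
      valid : ∀ (i : Fin k) →
        (Dominating (Block i) × Singleton (Block i))
        ⊎ (¬ Dominating (Block i) × (∃[ j ] Coalition (Block i) (Block j)))

  CoalitionNumberIs : ℕ → Set
  CoalitionNumberIs k = CoalitionPartition k × (∀ m → CoalitionPartition m → m ≤ k)

  -- G ∈ F₁ (up to isomorphism): the vertices of G can be labelled as
  -- x, y, w (distinct) and the rest split into P (inQ = false) and Q (inQ = true)
  -- satisfying the construction of F₁.
  record F₁-Structure : Set where
    field
      x y w : Fin n
      x≢y : x ≢ y
      x≢w : x ≢ w
      y≢w : y ≢ w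
      inQ : Fin n → Bool
    Rest : VSet
    Rest v = (v ≢ x) × (v ≢ y) × (v ≢ w)
    InP : VSet
    InP v = Rest v × inQ v ≡ false
    InQ : VSet
    InQ v = Rest v × inQ v ≡ true
    field
      restNonempty : ∃[ v ] Rest v
      Q≥2 : ∀ q → InQ q → ∃[ q' ] (InQ q' × q' ≢ q)
      Nx : ∀ u → (Adj x u → u ≡ y) × (u ≡ y → Adj x u)
      Nw : ∀ u → (Adj w u → Rest u) × (Rest u → Adj w u)
      Pcomplete : ∀ p u → InP p → Rest u → u ≢ p → Adj p u
      yQ : ∀ q → InQ q → Adj y q
      QnoFull : ∀ q → InQ q → ∃[ q' ] (InQ q' × q' ≢ q × ¬ Adj q q')
      -- no other edges: all remaining pairs are already constrained above
      -- (edges y–P and edges inside Q are arbitrary)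

  InF₁ : Set
  InF₁ = F₁-Structure

-- If C(G) = n, every block of a maximum coalition partition is a single vertex, so each
-- vertex r has a partner u with N[r] ∪ N[u] = V. Let x be a leaf with neighbour y and w a
-- non-neighbour of y. A vertex r ∉ {x, y} cannot dominate x, so its partner is x or y;
-- either way every non-neighbour of r outside {x, y} is a neighbour of y. Taking the
-- non-neighbour w of y shows that w sees every vertex outside {x, y, w} and nothing else.
-- The remaining vertices split into P (adjacent to all the others) and Q (with a
-- non-neighbour among them); Q-vertices come in non-adjacent pairs and all see y.
-- Conversely, in a graph of F₁ the pairs {x, w}, {y, w}, {p, x} (p ∈ P) and {q, y} (q ∈ Q)
-- dominate while no single vertex does, so the partition into singletons is a coalition
-- partition.
module Submission where

open import Defs hiding (sym)
open import Data.Nat using (ℕ; zero; suc; _+_; _∸_; _≤_; z≤n; s≤s)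
open import Data.Nat.Properties using (1+n≰n; m≤n+m; ≤-trans; ≤-refl)
import Data.Nat.Properties as ℕ
open import Data.Bool using (Bool; true; false; if_then_else_)
open import Data.Bool.Properties using () renaming (_≟_ to _≟ᵇ_)
open import Data.Fin using (Fin; zero; suc; punchOut)
open import Data.Fin.Properties using (any?; injective⇒≤; punchOut-injective; suc-injective; _≟_)
open import Data.List using (tabulate)
open import Data.List.Properties using (map-tabulate)
open import Data.Nat.ListAction using (sum)
open import Data.Product using (∃-syntax; _×_; _,_; proj₁; proj₂)
open import Data.Sum using (_⊎_; inj₁; inj₂; [_,_]′; swap)
import Data.Sum as Sum
open import Data.Empty using (⊥-elim)
open import Function using (_∘_; id)
open import Function.Bundles using (_⇔_; mk⇔)
open import Function.Definitions using (Injective)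
open import Relation.Nullary using (¬_; Dec; yes; no; does; contradiction)
open import Relation.Nullary.Decidable using (¬?; _×-dec_; dec-true; decidable-stable)
open import Relation.Binary.PropositionalEquality using (_≡_; _≢_; refl; sym; trans; cong; subst)

does-true : ∀ {A : Set} (a? : Dec A) → does a? ≡ true → A
does-true (yes a) _ = a

does-false : ∀ {A : Set} (a? : Dec A) → does a? ≡ false → ¬ A
does-false (no ¬a) _ = ¬a

injective⇒surjective : ∀ {n} {s : Fin n → Fin n} → Injective _≡_ _≡_ s → ∀ a → ∃[ j ] s j ≡ a
injective⇒surjective {suc m} {s} s-inj a with any? (λ j → s j ≟ a)
... | yes hit = hit
... | no miss = contradiction (injective⇒≤ {f = λ j → punchOut (a≢s j)} punched-inj) 1+n≰n
  where
  a≢s : ∀ j → a ≢ s j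
  a≢s j a≡sj = miss (j , sym a≡sj)
  punched-inj : ∀ {i j} → punchOut (a≢s i) ≡ punchOut (a≢s j) → i ≡ j
  punched-inj = s-inj ∘ punchOut-injective (a≢s _) (a≢s _)

section⇒injective : ∀ {n} {f s : Fin n → Fin n} → (∀ i → f (s i) ≡ i) → Injective _≡_ _≡_ f
section⇒injective {f = f} {s} f∘s≗id {a} {b} fa≡fb =
  trans (retract a) (trans (cong s fa≡fb) (sym (retract b)))
  where
  s-inj : Injective _≡_ _≡_ s
  s-inj {i} {j} si≡sj = trans (sym (f∘s≗id i)) (trans (cong f si≡sj) (f∘s≗id j))
  retract : ∀ a → a ≡ s (f a)
  retract a with j , refl ← injective⇒surjective s-inj a = cong s (sym (f∘s≗id j))

count : ∀ {n} → (Fin n → Bool) → ℕ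
count {zero}  f = 0
count {suc n} f = (if f zero then 1 else 0) + count (f ∘ suc)

sum-tabulate≡count : ∀ {n} (f : Fin n → Bool) →
                     sum (tabulate (λ u → if f u then 1 else 0)) ≡ count f
sum-tabulate≡count {zero}  f = refl
sum-tabulate≡count {suc n} f = cong ((if f zero then 1 else 0) +_) (sum-tabulate≡count (f ∘ suc))

true⇒1≤count : ∀ {n} (f : Fin n → Bool) {a} → f a ≡ true → 1 ≤ count f
true⇒1≤count f {zero}  fa rewrite fa = s≤s z≤n
true⇒1≤count f {suc a} fa = ≤-trans (true⇒1≤count (f ∘ suc) fa) (m≤n+m _ _)

1≤count⇒true : ∀ {n} (f : Fin n → Bool) → 1 ≤ count f → ∃[ a ] f a ≡ true
1≤count⇒true {suc n} f 1≤c with f zero in f0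
... | true  = zero , f0
... | false with a , fa ← 1≤count⇒true (f ∘ suc) 1≤c = suc a , fa

count≡1⇒unique : ∀ {n} (f : Fin n → Bool) → count f ≡ 1 →
                 ∀ {a b} → f a ≡ true → f b ≡ true → a ≡ b
count≡1⇒unique {suc n} f c {a} {b} fa fb with f zero in f0
... | true = trans (onlyHead fa) (sym (onlyHead fb))
  where
  onlyHead : ∀ {a} → f a ≡ true → a ≡ zero
  onlyHead {zero}  _  = refl
  onlyHead {suc a} fa with () ← subst (1 ≤_) (ℕ.suc-injective c) (true⇒1≤count (f ∘ suc) fa)
count≡1⇒unique {suc n} f c {zero}  {_}     fa fb | false = contradiction (trans (sym fa) f0) λ ()
count≡1⇒unique {suc n} f c {_}     {zero}  fa fb | false = contradiction (trans (sym fb) f0) λ ()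
count≡1⇒unique {suc n} f c {suc a} {suc b} fa fb | false = cong suc (count≡1⇒unique (f ∘ suc) c fa fb)

count≡n∸1 : ∀ {n} (f : Fin n → Bool) v → f v ≡ false → (∀ u → u ≢ v → f u ≡ true) →
            count f ≡ n ∸ 1
count≡n∸1 f zero fv others rewrite fv = count≡n (λ u → others (suc u) λ ())
  where
  count≡n : ∀ {n} {f : Fin n → Bool} → (∀ u → f u ≡ true) → count f ≡ n
  count≡n {zero}  all = refl
  count≡n {suc n} all rewrite all zero = cong suc (count≡n (all ∘ suc))
count≡n∸1 {suc (suc n)} f (suc v) fv others rewrite others zero (λ ()) =
  cong suc (count≡n∸1 (f ∘ suc) v fv λ u u≢v → others (suc u) (u≢v ∘ suc-injective))

module _ {n : ℕ} (G : Graph n) where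

  adj? : ∀ u v → Dec (Adj G u v)
  adj? u v = adj G u v ≟ᵇ true

  adj-sym : ∀ {u v} → Adj G u v → Adj G v u
  adj-sym {u} {v} = trans (Graph.sym G v u)

  adj-irrefl : ∀ {v} → ¬ Adj G v v
  adj-irrefl {v} vv with () ← trans (sym vv) (irrefl G v)

  degree≡count : ∀ v → degree G v ≡ count (adj G v)
  degree≡count v = trans (cong sum (map-tabulate {n = n} id (λ u → if adj G v u then 1 else 0)))
                         (sum-tabulate≡count (adj G v))

  1≤degree⇒neighbour : ∀ {v} → 1 ≤ degree G v → ∃[ u ] Adj G v u
  1≤degree⇒neighbour {v} = 1≤count⇒true (adj G v) ∘ subst (1 ≤_) (degree≡count v)

  degree≡1⇒uniqueNeighbour : ∀ {v} → degree G v ≡ 1 →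
                             ∃[ u ] (Adj G v u × ∀ t → Adj G v t → t ≡ u)
  degree≡1⇒uniqueNeighbour {v} deg≡1
    with u , v~u ← 1≤degree⇒neighbour (subst (1 ≤_) (sym deg≡1) ≤-refl) =
    u , v~u , λ t v~t → count≡1⇒unique (adj G v) (trans (sym (degree≡count v)) deg≡1) v~t v~u

  nonFull⇒nonNeighbour : ∀ {v} → ¬ FullVertex G v → ∃[ t ] (t ≢ v × ¬ Adj G v t)
  nonFull⇒nonNeighbour {v} notFull with any? (λ t → ¬? (t ≟ v) ×-dec ¬? (adj? v t))
  ... | yes found = found
  ... | no none = contradiction full notFull
    where
    full : FullVertex G v
    full = trans (degree≡count v) (count≡n∸1 (adj G v) v (irrefl G v)
             λ t t≢v → decidable-stable (adj? v t) λ v≁t → none (t , t≢v , v≁t))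

  N[_] : Fin n → VSet G
  N[ v ] t = t ≡ v ⊎ Adj G v t

  Covers : Fin n → Fin n → Set
  Covers i j = ∀ t → N[ i ] t ⊎ N[ j ] t

  covers⇒dominating : ∀ {i j} → Covers i j → Dominating G (λ v → v ≡ i ⊎ v ≡ j)
  covers⇒dominating {i} {j} cover t with cover t
  ... | inj₁ (inj₁ t≡i) = inj₁ (inj₁ t≡i)
  ... | inj₁ (inj₂ i~t) = inj₂ (i , inj₁ refl , i~t)
  ... | inj₂ (inj₁ t≡j) = inj₁ (inj₂ t≡j)
  ... | inj₂ (inj₂ j~t) = inj₂ (j , inj₂ refl , j~t)

  dominating⇒covers : ∀ {S i j} → Dominating G S → (∀ v → S v → v ≡ i ⊎ v ≡ j) → Covers i j
  dominating⇒covers {S} dom S⊆ij t with dom t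
  ... | inj₁ t∈S = Sum.map inj₁ inj₁ (S⊆ij t t∈S)
  ... | inj₂ (u , u∈S , u~t) with S⊆ij u u∈S
  ...   | inj₁ refl = inj₁ (inj₂ u~t)
  ...   | inj₂ refl = inj₂ (inj₂ u~t)

  nonFull⇒¬dominatingSingleton : ∀ {v} → ¬ FullVertex G v → ¬ Dominating G (_≡ v)
  nonFull⇒¬dominatingSingleton notFull dom with t , t≢v , v≁t ← nonFull⇒nonNeighbour notFull with dom t
  ... | inj₁ t≡v = t≢v t≡v
  ... | inj₂ (_ , refl , v~t) = v≁t v~t

  module _ {k : ℕ} (Ψ : CoalitionPartition G k) where
    open CoalitionPartition Ψ

    representative : Fin k → Fin n
    representative i = proj₁ (nonempty i)

    part-representative : ∀ i → part (representative i) ≡ i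
    part-representative i = proj₂ (nonempty i)

  coalitionPartition≤order : ∀ {k} → CoalitionPartition G k → k ≤ n
  coalitionPartition≤order Ψ = injective⇒≤ {f = representative Ψ} λ {i} {j} e →
    trans (sym (part-representative Ψ i)) (trans (cong (CoalitionPartition.part Ψ) e) (part-representative Ψ j))

  -- With n blocks the surjection part is injective: every block is a single vertex.
  orderPartition⇒partners : CoalitionPartition G n → ∀ r → ∃[ u ] Covers r u
  orderPartition⇒partners Ψ r = [ (λ (dom , _) → r , dominating⇒covers dom λ _ → inj₁ ∘ part-inj)
                                 , (λ (_ , j , _ , _ , _ , dom) → representative Ψ j ,
                                      dominating⇒covers dom λ _ → Sum.map part-inj (inBlock j)) ]′
                                 (valid (part r))
    where
    open CoalitionPartition Ψ
    part-inj : Injective _≡_ _≡_ part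
    part-inj = section⇒injective (part-representative Ψ)
    inBlock : ∀ j {u} → part u ≡ j → u ≡ representative Ψ j
    inBlock j pu≡j = part-inj (trans pu≡j (sym (part-representative Ψ j)))

  singletonCoalitionPartition : (∀ v → ¬ Dominating G (_≡ v)) →
                                (∀ v → ∃[ u ] (u ≢ v × Covers v u)) → CoalitionPartition G n
  singletonCoalitionPartition ¬dom partner = record
    { part     = id
    ; nonempty = λ i → i , refl
    ; valid    = λ i → let (j , j≢i , cover) = partner i in
        inj₂ (¬dom i , j , (λ _ v≡i v≡j → j≢i (trans (sym v≡j) v≡i)) , ¬dom i , ¬dom j ,
              covers⇒dominating cover)
    }

module LeafStructure {n : ℕ} {G : Graph n} (partners : ∀ r → ∃[ u ] Covers G r u)
                     (minDegree≥1 : ∀ v → 1 ≤ degree G v)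
                     {x y w : Fin n} (x~y : Adj G x y) (leaf : ∀ t → Adj G x t → t ≡ y)
                     (w≢y : w ≢ y) (y≁w : ¬ Adj G y w) where

  x≢y : x ≢ y
  x≢y x≡y = adj-irrefl G (subst (Adj G x) (sym x≡y) x~y)

  x≢w : x ≢ w
  x≢w x≡w = y≁w (subst (Adj G y) x≡w (adj-sym G x~y))

  partner-of-inner : ∀ {r u} → r ≢ x → r ≢ y → Covers G r u → u ≡ x ⊎ u ≡ y
  partner-of-inner r≢x r≢y cover with cover x
  ... | inj₁ (inj₁ x≡r) = ⊥-elim (r≢x (sym x≡r))
  ... | inj₁ (inj₂ r~x) = ⊥-elim (r≢y (leaf _ (adj-sym G r~x)))
  ... | inj₂ (inj₁ x≡u) = inj₁ (sym x≡u)
  ... | inj₂ (inj₂ u~x) = inj₂ (leaf _ (adj-sym G u~x))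

  -- The partner of r is x or y; it cannot be x, since N[x] = {x, y} misses t.
  nonNeighbour⇒y-adjacent : ∀ {r t} → r ≢ x → r ≢ y → t ≢ x → t ≢ y → t ≢ r → ¬ Adj G r t →
                            Adj G y t
  nonNeighbour⇒y-adjacent {r} {t} r≢x r≢y t≢x t≢y t≢r r≁t
    with u , cover ← partners r
    with partner-of-inner r≢x r≢y cover | cover t
  ... | _         | inj₁ t∈N[r]        = ⊥-elim ([ t≢r , r≁t ]′ t∈N[r])
  ... | inj₁ refl | inj₂ (inj₁ t≡x) = ⊥-elim (t≢x t≡x)
  ... | inj₁ refl | inj₂ (inj₂ x~t) = ⊥-elim (t≢y (leaf t x~t))
  ... | inj₂ refl | inj₂ (inj₁ t≡y) = ⊥-elim (t≢y t≡y)
  ... | inj₂ refl | inj₂ (inj₂ y~t) = y~t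

  Rest : Fin n → Set
  Rest v = v ≢ x × v ≢ y × v ≢ w

  rest? : ∀ v → Dec (Rest v)
  rest? v = ¬? (v ≟ x) ×-dec ¬? (v ≟ y) ×-dec ¬? (v ≟ w)

  w-adjacent-rest : ∀ {r} → Rest r → Adj G w r
  w-adjacent-rest {r} (r≢x , r≢y , r≢w) with adj? G w r
  ... | yes w~r = w~r
  ... | no w≁r = ⊥-elim (y≁w (nonNeighbour⇒y-adjacent r≢x r≢y (x≢w ∘ sym) w≢y (r≢w ∘ sym)
                                                        (w≁r ∘ adj-sym G)))

  w-neighbour-rest : ∀ {u} → Adj G w u → Rest u
  w-neighbour-rest w~u = (λ { refl → w≢y (leaf _ (adj-sym G w~u)) })
                       , (λ { refl → y≁w (adj-sym G w~u) })
                       , (λ { refl → adj-irrefl G w~u })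

  RestNonNeighbour : Fin n → Fin n → Set
  RestNonNeighbour r t = Rest t × t ≢ r × ¬ Adj G r t

  hasRestNonNeighbour? : ∀ r → Dec (∃[ t ] RestNonNeighbour r t)
  hasRestNonNeighbour? r = any? λ t → rest? t ×-dec ¬? (t ≟ r) ×-dec ¬? (adj? G r t)

  inQ : Fin n → Bool
  inQ r = does (hasRestNonNeighbour? r)

  Q-pair : ∀ {q} → Rest q → inQ q ≡ true → ∃[ t ] ((Rest t × inQ t ≡ true) × t ≢ q × ¬ Adj G q t)
  Q-pair {q} rest-q q∈Q with t , rest-t , t≢q , q≁t ← does-true (hasRestNonNeighbour? q) q∈Q =
    t , (rest-t , dec-true (hasRestNonNeighbour? t) (q , rest-q , t≢q ∘ sym , q≁t ∘ adj-sym G)) , t≢q , q≁t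

  structure : F₁-Structure G
  structure = record
    { x = x ; y = y ; w = w
    ; x≢y = x≢y ; x≢w = x≢w ; y≢w = w≢y ∘ sym
    ; inQ = inQ
    ; restNonempty = let (u , w~u) = 1≤degree⇒neighbour G (minDegree≥1 w) in u , w-neighbour-rest w~u
    ; Q≥2 = λ q (rest-q , q∈Q) → let (t , t∈Q , t≢q , _) = Q-pair rest-q q∈Q in t , t∈Q , t≢q
    ; Nx = λ u → leaf u , λ { refl → x~y }
    ; Nw = λ u → w-neighbour-rest , w-adjacent-rest
    ; Pcomplete = λ p u (_ , p∈P) rest-u u≢p → decidable-stable (adj? G p u) λ p≁u →
                    does-false (hasRestNonNeighbour? p) p∈P (u , rest-u , u≢p , p≁u)
    ; yQ = λ q ((q≢x , q≢y , _) , q∈Q) →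
             let (t , (t≢x , t≢y , _) , q≢t , t≁q) = does-true (hasRestNonNeighbour? q) q∈Q in
             nonNeighbour⇒y-adjacent t≢x t≢y q≢x q≢y (q≢t ∘ sym) (t≁q ∘ adj-sym G)
    ; QnoFull = λ q (rest-q , q∈Q) → Q-pair rest-q q∈Q
    }

module F₁-Partners {n : ℕ} {G : Graph n} (F : F₁-Structure G) where
  open F₁-Structure F

  vertex-cases : ∀ t → t ≡ x ⊎ t ≡ y ⊎ t ≡ w ⊎ Rest t
  vertex-cases t with t ≟ x | t ≟ y | t ≟ w
  ... | yes t≡x | _       | _       = inj₁ t≡x
  ... | no t≢x  | yes t≡y | _       = inj₂ (inj₁ t≡y)
  ... | no t≢x  | no t≢y  | yes t≡w = inj₂ (inj₂ (inj₁ t≡w))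
  ... | no t≢x  | no t≢y  | no t≢w  = inj₂ (inj₂ (inj₂ (t≢x , t≢y , t≢w)))

  x~y : Adj G x y
  x~y = proj₂ (Nx y) refl

  xy-closed : ∀ {u} → u ≡ x ⊎ u ≡ y → N[_] G u x × N[_] G u y
  xy-closed (inj₁ refl) = inj₁ refl , inj₂ x~y
  xy-closed (inj₂ refl) = inj₂ (adj-sym G x~y) , inj₁ refl

  covers-w : ∀ {u} → u ≡ x ⊎ u ≡ y → Covers G u w
  covers-w u∈xy t with vertex-cases t
  ... | inj₁ refl                   = inj₁ (proj₁ (xy-closed u∈xy))
  ... | inj₂ (inj₁ refl)            = inj₁ (proj₂ (xy-closed u∈xy))
  ... | inj₂ (inj₂ (inj₁ refl))     = inj₂ (inj₁ refl)
  ... | inj₂ (inj₂ (inj₂ rest-t))   = inj₂ (inj₂ (proj₂ (Nw t) rest-t))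

  covers-rest : ∀ {v u} → Rest v → u ≡ x ⊎ u ≡ y →
                (∀ t → Rest t → t ≢ v → Adj G v t ⊎ Adj G u t) → Covers G v u
  covers-rest {v} rest-v u∈xy onRest t with vertex-cases t
  ... | inj₁ refl                 = inj₂ (proj₁ (xy-closed u∈xy))
  ... | inj₂ (inj₁ refl)          = inj₂ (proj₂ (xy-closed u∈xy))
  ... | inj₂ (inj₂ (inj₁ refl))   = inj₁ (inj₂ (adj-sym G (proj₂ (Nw v) rest-v)))
  ... | inj₂ (inj₂ (inj₂ rest-t)) with t ≟ v
  ...   | yes t≡v = inj₁ (inj₁ t≡v)
  ...   | no t≢v  = Sum.map inj₂ inj₂ (onRest t rest-t t≢v)

  partner : ∀ v → ∃[ u ] (u ≢ v × Covers G v u)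
  partner v with vertex-cases v
  ... | inj₁ refl               = w , x≢w ∘ sym , covers-w (inj₁ refl)
  ... | inj₂ (inj₁ refl)        = w , y≢w ∘ sym , covers-w (inj₂ refl)
  ... | inj₂ (inj₂ (inj₁ refl)) = x , x≢w , swap ∘ covers-w (inj₁ refl)
  ... | inj₂ (inj₂ (inj₂ rest-v@(v≢x , v≢y , _))) with inQ v in v∈Q
  ...   | false = x , v≢x ∘ sym , covers-rest rest-v (inj₁ refl)
                    λ t rest-t t≢v → inj₁ (Pcomplete v t (rest-v , v∈Q) rest-t t≢v)
  ...   | true  = y , v≢y ∘ sym , covers-rest rest-v (inj₂ refl) onRest
    where
    onRest : ∀ t → Rest t → t ≢ v → Adj G v t ⊎ Adj G y t
    onRest t rest-t t≢v with inQ t in t∈Q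
    ... | true  = inj₂ (yQ t (rest-t , t∈Q))
    ... | false = inj₁ (adj-sym G (Pcomplete t v (rest-t , t∈Q) rest-v (t≢v ∘ sym)))

orderPartition⇒F₁ : ∀ {n} {G : Graph n} → CoalitionPartition G n → MinDegree G 1 → ¬ HasFullVertex G →
                    InF₁ G
orderPartition⇒F₁ {G = G} Ψ (minDegree≥1 , x , deg-x≡1) noFull
  with y , x~y , leaf ← degree≡1⇒uniqueNeighbour G deg-x≡1
  with w , w≢y , y≁w ← nonFull⇒nonNeighbour G (λ full → noFull (y , full)) =
  LeafStructure.structure (orderPartition⇒partners G Ψ) minDegree≥1 x~y leaf w≢y y≁w

F₁⇒coalitionNumber≡order : ∀ {n} {G : Graph n} → ¬ HasFullVertex G → InF₁ G → CoalitionNumberIs G n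
F₁⇒coalitionNumber≡order {G = G} noFull F =
  singletonCoalitionPartition G (λ v → nonFull⇒¬dominatingSingleton G (λ full → noFull (v , full)))
                                (F₁-Partners.partner F)
  , λ _ → coalitionPartition≤order G

theorem5 : ∀ (n : ℕ) (G : Graph n) → MinDegree G 1 → ¬ HasFullVertex G →
           (CoalitionNumberIs G n ⇔ InF₁ G)
theorem5 n G δ≡1 noFull =
  mk⇔ (λ (Ψ , _) → orderPartition⇒F₁ Ψ δ≡1 noFull) (F₁⇒coalitionNumber≡order noFull)
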